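{- Let $C_B=\sum_{n,k\ge0}c_B[n,k]t^k\frac{x^n}{[n]!}$. Then $C_B(0,t)=1$ and $$x^2q^2(1-q)D_q^2C_B+(1-q(1+q)x)D_qC_B-(1+t)C_B=0.$$
   Context: $[m]=(1-q^m)/(1-q)$, $[m]!=[m]\cdots[1]$. Define $c_B[0,k]=\delta_{0,k}$ ($k\in\mathbb{Z}$) and $c_B[n,k]=c_B[n-1,k-1]+[2n-1]c_B[n-1,k]$ for $n\ge1$. $D_q$ is the $q$-derivative with respect to $x$, $D_qf(x)=\frac{f(qx)-f(x)}{qx-x}$, acting on formal power series in $x$ (so $D_qx^n=[n]x^{n-1}$), with $t$ treated as a constant. -}

module Defs where

open import Level using (Level)
open import Data.Nat using (ℕ; zero; suc)
import Data.Nat as ℕ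
open import Algebra.Bundles using (CommutativeRing)

-- Everything is parameterised by a commutative ring R and an element q of R
-- (take R = ℤ[q] for the paper's formal q; the statement for arbitrary R
-- and q is the universal version).
module QSeries {c ℓ : Level} (R : CommutativeRing c ℓ) (q : CommutativeRing.Carrier R) where
  open CommutativeRing R using (Carrier; _+_; _*_; _-_; 0#; 1#)

  qpow : ℕ → Carrier
  qpow zero    = 1#
  qpow (suc i) = q * qpow i

  -- [m] = 1 + q + ... + q^(m-1)  ( = (1-q^m)/(1-q) )
  [_] : ℕ → Carrier
  [ zero ]  = 0#
  [ suc m ] = [ m ] + qpow m

  -- c_B[n,k] for k ≥ 0 (for k < 0 it is identically 0, by induction on n
  -- from c_B[0,k] = δ_{0,k}; so c_B[n-1,-1] = 0 in the k = 0 case).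
  cB : ℕ → ℕ → Carrier
  cB zero    zero    = 1#
  cB zero    (suc k) = 0#
  cB (suc n) zero    = [ suc (2 ℕ.* n) ] * cB n zero
  cB (suc n) (suc k) = cB n k + [ suc (2 ℕ.* n) ] * cB n (suc k)

  -- A formal power series  F = Σ_{n,k≥0} F n k · t^k x^n / [n]!
  -- is represented by its coefficient array  F : ℕ → ℕ → R
  -- (coefficient of t^k x^n/[n]!).
  Series : Set c
  Series = ℕ → ℕ → Carrier

  CB : Series
  CB = cB

  -- D_q (x^n/[n]!) = x^(n-1)/[n-1]!
  Dq : Series → Series
  Dq F n k = F (suc n) k

  -- x · (x^n/[n]!) = [n+1] x^(n+1)/[n+1]!
  mulX : Series → Series
  mulX F zero    k = 0#
  mulX F (suc n) k = [ suc n ] * F n k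

  mulT : Series → Series
  mulT F n zero    = 0#
  mulT F n (suc k) = F n k

  _·_ : Carrier → Series → Series
  (a · F) n k = a * F n k

  _⊕_ : Series → Series → Series
  (F ⊕ G) n k = F n k + G n k

  _⊖_ : Series → Series → Series
  (F ⊖ G) n k = F n k - G n k

  infixl 6 _⊕_ _⊖_
  infixr 7 _·_

  at-x0 : Series → ℕ → Carrier
  at-x0 F k = F zero k

  one : ℕ → Carrier
  one zero    = 1#
  one (suc k) = 0#

{-# OPTIONS --safe #-}
module Submission where

-- In the basis t^k x^n/[n]!, x D_q acts as multiplication by [n], x² D_q² as [n][n-1], and the
-- recurrence for c_B says D_q C_B = t C_B + [2n+1] C_B. So the operator multiplies c_B[n,k] by
-- q²(1-q)[n][n-1] + [2n+1] - 1 - q(1+q)[n], which vanishes because [2n+1] = 1 + q(1+qⁿ)[n]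
-- and (1-q)[n-1] = 1 - qⁿ⁻¹.

open import Data.Nat as ℕ using (ℕ; zero; suc; pred)
import Data.Nat.Properties as ℕₚ
open import Data.Integer as ℤ using (ℤ; +_; -[1+_]; sign; ∣_∣; _◃_)
open import Data.Integer.Properties using ([1+m]⊖[1+n]≡m⊖n)
open import Data.Sign as Sign using (Sign)
open import Algebra.Bundles using (CommutativeRing)
open import Algebra.Solver.Ring.AlmostCommutativeRing
  using (fromCommutativeRing; _-Raw-AlmostCommutative⟶_)
import Algebra.Solver.Ring as RingSolver
open import Relation.Binary.Consequences using (dec⇒weaklyDec)
import Relation.Binary.PropositionalEquality as ≡
open import Data.Maybe using (Maybe; map)
open import Function using (_∘_)
open import Data.Product using (_×_; _,_)
open import Defs

-- The library's ring solver needs a coefficient ring that computes; over an arbitrary commutative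
-- ring the canonical one is ℤ, via its unique homomorphism into R.
module IntegerCoefficients {c ℓ} (R : CommutativeRing c ℓ) where
  open CommutativeRing R
  open import Algebra.Properties.Ring ring
    using (-0#≈0#; -‿involutive; -‿distribˡ-*; -‿distribʳ-*; -‿+-comm)
  open import Algebra.Properties.CommutativeSemigroup +-commutativeSemigroup
    using (interchange)
  open import Algebra.Properties.Semiring.Mult.TCOptimised semiring
    using (×-homo-+; ×1-homo-*) renaming (_×_ to _×′_)
  open import Relation.Binary.Reasoning.Setoid setoid

  signed : Sign → Carrier → Carrier
  signed Sign.+ x = x
  signed Sign.- x = - x

  -- With the optimised multiple, ⟦ + 1 ⟧ reduces to 1#, so con (+ 1) is 1# on the nose.
  ⟦_⟧ : ℤ → Carrier
  ⟦ i ⟧ = signed (sign i) (∣ i ∣ ×′ 1#)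

  signed-cong : ∀ s {x y} → x ≈ y → signed s x ≈ signed s y
  signed-cong Sign.+ x≈y = x≈y
  signed-cong Sign.- x≈y = -‿cong x≈y

  signed-* : ∀ s t x y → signed (s Sign.* t) (x * y) ≈ signed s x * signed t y
  signed-* Sign.+ Sign.+ x y = refl
  signed-* Sign.+ Sign.- x y = -‿distribʳ-* x y
  signed-* Sign.- Sign.+ x y = -‿distribˡ-* x y
  signed-* Sign.- Sign.- x y = begin
    x * y         ≈⟨ -‿involutive (x * y) ⟨
    - - (x * y)   ≈⟨ -‿cong (-‿distribˡ-* x y) ⟩
    - (- x * y)   ≈⟨ -‿distribʳ-* (- x) y ⟩
    - x * - y     ∎

  ⟦◃⟧ : ∀ s n → ⟦ s ◃ n ⟧ ≈ signed s (n ×′ 1#)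
  ⟦◃⟧ Sign.+ zero    = refl
  ⟦◃⟧ Sign.- zero    = sym -0#≈0#
  ⟦◃⟧ Sign.+ (suc n) = refl
  ⟦◃⟧ Sign.- (suc n) = refl

  [x+y]-[x+z]≈y-z : ∀ x y z → (x + y) - (x + z) ≈ y - z
  [x+y]-[x+z]≈y-z x y z = begin
    (x + y) - (x + z)        ≈⟨ +-congˡ (-‿+-comm x z) ⟨
    (x + y) + (- x + - z)    ≈⟨ interchange x y (- x) (- z) ⟩
    (x - x) + (y - z)        ≈⟨ +-congʳ (-‿inverseʳ x) ⟩
    0# + (y - z)             ≈⟨ +-identityˡ (y - z) ⟩
    y - z                    ∎

  ⟦⊖⟧ : ∀ m n → ⟦ m ℤ.⊖ n ⟧ ≈ m ×′ 1# - n ×′ 1#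
  ⟦⊖⟧ m       zero    = sym (trans (+-congˡ -0#≈0#) (+-identityʳ _))
  ⟦⊖⟧ zero    (suc n) = sym (+-identityˡ _)
  ⟦⊖⟧ (suc m) (suc n) = begin
    ⟦ suc m ℤ.⊖ suc n ⟧              ≡⟨ ≡.cong ⟦_⟧ ([1+m]⊖[1+n]≡m⊖n m n) ⟩
    ⟦ m ℤ.⊖ n ⟧                      ≈⟨ ⟦⊖⟧ m n ⟩
    m ×′ 1# - n ×′ 1#                ≈⟨ [x+y]-[x+z]≈y-z 1# (m ×′ 1#) (n ×′ 1#) ⟨
    (1# + m ×′ 1#) - (1# + n ×′ 1#)  ≈⟨ +-cong (×-homo-+ 1# 1 m) (-‿cong (×-homo-+ 1# 1 n)) ⟨
    suc m ×′ 1# - suc n ×′ 1#        ∎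

  +-homo : ∀ i j → ⟦ i ℤ.+ j ⟧ ≈ ⟦ i ⟧ + ⟦ j ⟧
  +-homo -[1+ m ] -[1+ n ] = begin
    - (suc (suc (m ℕ.+ n)) ×′ 1#)      ≡⟨ ≡.cong (λ k → - (suc k ×′ 1#)) (ℕₚ.+-suc m n) ⟨
    - ((suc m ℕ.+ suc n) ×′ 1#)        ≈⟨ -‿cong (×-homo-+ 1# (suc m) (suc n)) ⟩
    - (suc m ×′ 1# + suc n ×′ 1#)      ≈⟨ -‿+-comm _ _ ⟨
    - (suc m ×′ 1#) + - (suc n ×′ 1#)  ∎
  +-homo -[1+ m ] (+ n)    = trans (⟦⊖⟧ n (suc m)) (+-comm _ _)
  +-homo (+ m)    -[1+ n ] = ⟦⊖⟧ m (suc n)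
  +-homo (+ m)    (+ n)    = ×-homo-+ 1# m n

  *-homo : ∀ i j → ⟦ i ℤ.* j ⟧ ≈ ⟦ i ⟧ * ⟦ j ⟧
  *-homo i j = begin
    ⟦ s ◃ (∣ i ∣ ℕ.* ∣ j ∣) ⟧                 ≈⟨ ⟦◃⟧ s (∣ i ∣ ℕ.* ∣ j ∣) ⟩
    signed s ((∣ i ∣ ℕ.* ∣ j ∣) ×′ 1#)        ≈⟨ signed-cong s (×1-homo-* ∣ i ∣ ∣ j ∣) ⟩
    signed s (∣ i ∣ ×′ 1# * ∣ j ∣ ×′ 1#)      ≈⟨ signed-* (sign i) (sign j) _ _ ⟩
    ⟦ i ⟧ * ⟦ j ⟧                             ∎
    where
    s : Sign
    s = sign i Sign.* sign j

  -‿homo : ∀ i → ⟦ ℤ.- i ⟧ ≈ - ⟦ i ⟧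
  -‿homo (+ zero)  = sym -0#≈0#
  -‿homo (+ suc n) = refl
  -‿homo -[1+ n ]  = sym (-‿involutive _)

  ℤ⟶R : ℤ.+-*-rawRing -Raw-AlmostCommutative⟶ fromCommutativeRing R
  ℤ⟶R = record
    { ⟦_⟧    = ⟦_⟧
    ; +-homo = +-homo
    ; *-homo = *-homo
    ; -‿homo = -‿homo
    ; 0-homo = refl
    ; 1-homo = refl
    }

  ⟦⟧-weaklyDec : ∀ i j → Maybe (⟦ i ⟧ ≈ ⟦ j ⟧)
  ⟦⟧-weaklyDec i j = map (reflexive ∘ ≡.cong ⟦_⟧) (dec⇒weaklyDec ℤ._≟_ i j)

  open RingSolver ℤ.+-*-rawRing (fromCommutativeRing R) ℤ⟶R ⟦⟧-weaklyDec public
    using (solve; _:=_; con; _:+_; _:*_; _:-_)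

module QDifferentialEquation {c ℓ} (R : CommutativeRing c ℓ) (q : CommutativeRing.Carrier R) where
  open CommutativeRing R
  open import Algebra.Properties.Ring ring using (x≈y⇒x∙y⁻¹≈ε)
  open QSeries R q
  open IntegerCoefficients R using (solve; _:=_; con; _:+_; _:*_; _:-_)
  open import Relation.Binary.Reasoning.Setoid setoid

  [1+m]≈1+q[m] : ∀ m → [ suc m ] ≈ 1# + q * [ m ]
  [1+m]≈1+q[m] zero    = solve 1 (λ q → con (+ 0) :+ con (+ 1) := con (+ 1) :+ q :* con (+ 0)) refl q
  [1+m]≈1+q[m] (suc m) = begin
    [ suc m ] + q * qpow m          ≈⟨ +-congʳ ([1+m]≈1+q[m] m) ⟩
    1# + q * [ m ] + q * qpow m     ≈⟨ +-assoc 1# _ _ ⟩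
    1# + (q * [ m ] + q * qpow m)   ≈⟨ +-congˡ (distribˡ q [ m ] (qpow m)) ⟨
    1# + q * ([ m ] + qpow m)       ∎

  [m+n]≈[m]+qᵐ[n] : ∀ m n → [ m ℕ.+ n ] ≈ [ m ] + qpow m * [ n ]
  [m+n]≈[m]+qᵐ[n] zero    n = solve 1 (λ x → x := con (+ 0) :+ con (+ 1) :* x) refl [ n ]
  [m+n]≈[m]+qᵐ[n] (suc m) n = begin
    [ suc (m ℕ.+ n) ]                         ≈⟨ [1+m]≈1+q[m] (m ℕ.+ n) ⟩
    1# + q * [ m ℕ.+ n ]                      ≈⟨ +-congˡ (*-congˡ ([m+n]≈[m]+qᵐ[n] m n)) ⟩
    1# + q * ([ m ] + qpow m * [ n ])         ≈⟨ regroup q [ m ] (qpow m) [ n ] ⟩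
    (1# + q * [ m ]) + q * qpow m * [ n ]     ≈⟨ +-congʳ ([1+m]≈1+q[m] m) ⟨
    [ suc m ] + qpow (suc m) * [ n ]          ∎
    where
    regroup : ∀ q a p b → 1# + q * (a + p * b) ≈ (1# + q * a) + q * p * b
    regroup = solve 4 (λ q a p b →
      con (+ 1) :+ q :* (a :+ p :* b) := (con (+ 1) :+ q :* a) :+ q :* p :* b) refl

  [1-q][m]≈1-qᵐ : ∀ m → (1# - q) * [ m ] ≈ 1# - qpow m
  [1-q][m]≈1-qᵐ zero    = solve 1 (λ q → (con (+ 1) :- q) :* con (+ 0) := con (+ 1) :- con (+ 1)) refl q
  [1-q][m]≈1-qᵐ (suc m) = begin
    (1# - q) * ([ m ] + qpow m)              ≈⟨ expand q [ m ] (qpow m) ⟩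
    (1# - q) * [ m ] + (qpow m - q * qpow m) ≈⟨ +-congʳ ([1-q][m]≈1-qᵐ m) ⟩
    (1# - qpow m) + (qpow m - q * qpow m)    ≈⟨ telescope q (qpow m) ⟩
    1# - q * qpow m                          ∎
    where
    expand : ∀ q a p → (1# - q) * (a + p) ≈ (1# - q) * a + (p - q * p)
    expand = solve 3 (λ q a p →
      (con (+ 1) :- q) :* (a :+ p) := (con (+ 1) :- q) :* a :+ (p :- q :* p)) refl
    telescope : ∀ q p → (1# - p) + (p - q * p) ≈ 1# - q * p
    telescope = solve 2 (λ q p → (con (+ 1) :- p) :+ (p :- q :* p) := con (+ 1) :- q :* p) refl

  [1+2n]≈1+q[n]+qⁿ⁺¹[n] : ∀ n → [ suc (2 ℕ.* n) ] ≈ 1# + q * ([ n ] + qpow n * [ n ])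
  [1+2n]≈1+q[n]+qⁿ⁺¹[n] n = begin
    [ suc (2 ℕ.* n) ]                  ≈⟨ [1+m]≈1+q[m] (2 ℕ.* n) ⟩
    1# + q * [ n ℕ.+ (n ℕ.+ 0) ]       ≡⟨ ≡.cong (λ m → 1# + q * [ n ℕ.+ m ]) (ℕₚ.+-identityʳ n) ⟩
    1# + q * [ n ℕ.+ n ]               ≈⟨ +-congˡ (*-congˡ ([m+n]≈[m]+qᵐ[n] n n)) ⟩
    1# + q * ([ n ] + qpow n * [ n ])  ∎

  multiplier : ℕ → Carrier
  multiplier n = q * q * (1# - q) * ([ n ] * [ pred n ]) + ([ suc (2 ℕ.* n) ] - 1#) - q * (1# + q) * [ n ]

  multiplier≈0 : ∀ n → multiplier n ≈ 0#
  multiplier≈0 zero    = solve 1 (λ q →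
    q :* q :* (con (+ 1) :- q) :* (con (+ 0) :* con (+ 0)) :+ ((con (+ 0) :+ con (+ 1)) :- con (+ 1))
      :- q :* (con (+ 1) :+ q) :* con (+ 0) := con (+ 0)) refl q
  multiplier≈0 (suc m) = begin
    multiplier (suc m)
      ≈⟨ +-congʳ (+-congˡ (+-congʳ ([1+2n]≈1+q[n]+qⁿ⁺¹[n] (suc m)))) ⟩
    q * q * (1# - q) * (a * b) + ((1# + q * (a + q * p * a)) - 1#) - q * (1# + q) * a
      ≈⟨ regroup q a b p ⟩
    q * q * a * ((1# - q) * b - (1# - p))
      ≈⟨ *-congˡ (x≈y⇒x∙y⁻¹≈ε ([1-q][m]≈1-qᵐ m)) ⟩
    q * q * a * 0#
      ≈⟨ zeroʳ _ ⟩
    0# ∎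
    where
    a b p : Carrier
    a = [ suc m ]
    b = [ m ]
    p = qpow m
    regroup : ∀ q a b p →
      q * q * (1# - q) * (a * b) + ((1# + q * (a + q * p * a)) - 1#) - q * (1# + q) * a
        ≈ q * q * a * ((1# - q) * b - (1# - p))
    regroup = solve 4 (λ q a b p →
      q :* q :* (con (+ 1) :- q) :* (a :* b) :+ ((con (+ 1) :+ q :* (a :+ q :* p :* a)) :- con (+ 1))
        :- q :* (con (+ 1) :+ q) :* a
      := q :* q :* a :* ((con (+ 1) :- q) :* b :- (con (+ 1) :- p))) refl

  mulX-Dq : ∀ F n k → mulX (Dq F) n k ≈ [ n ] * F n k
  mulX-Dq F zero    k = sym (zeroˡ _)
  mulX-Dq F (suc n) k = refl

  mulX²-Dq² : ∀ F n k → mulX (mulX (Dq (Dq F))) n k ≈ [ n ] * [ pred n ] * F n k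
  mulX²-Dq² F zero    k = sym (trans (*-congʳ (zeroˡ _)) (zeroˡ _))
  mulX²-Dq² F (suc n) k = begin
    [ suc n ] * mulX (Dq (Dq F)) n k    ≈⟨ *-congˡ (mulX-Dq (Dq F) n k) ⟩
    [ suc n ] * ([ n ] * F (suc n) k)   ≈⟨ *-assoc _ _ _ ⟨
    [ suc n ] * [ n ] * F (suc n) k     ∎

  Dq-CB : ∀ n k → Dq CB n k ≈ mulT CB n k + [ suc (2 ℕ.* n) ] * CB n k
  Dq-CB n zero    = sym (+-identityˡ _)
  Dq-CB n (suc k) = refl

  CB-at-x0 : ∀ k → at-x0 CB k ≈ one k
  CB-at-x0 zero    = refl
  CB-at-x0 (suc k) = refl

  CB-equation : (n k : ℕ) →
    ( (q * q * (1# - q)) · mulX (mulX (Dq (Dq CB)))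
      ⊕ (Dq CB ⊖ (q * (1# + q)) · mulX (Dq CB))
      ⊖ (CB ⊕ mulT CB) ) n k ≈ 0#
  CB-equation n k = begin
    q * q * (1# - q) * mulX (mulX (Dq (Dq CB))) n k + (Dq CB n k - q * (1# + q) * mulX (Dq CB) n k)
      - (X + Y)
      ≈⟨ +-congʳ (+-cong (*-congˡ (mulX²-Dq² CB n k))
                         (+-cong (Dq-CB n k) (-‿cong (*-congˡ (mulX-Dq CB n k))))) ⟩
    q * q * (1# - q) * ([ n ] * [ pred n ] * X) + ((Y + [ suc (2 ℕ.* n) ] * X) - q * (1# + q) * ([ n ] * X))
      - (X + Y)
      ≈⟨ collect q [ n ] [ pred n ] [ suc (2 ℕ.* n) ] X Y ⟩
    multiplier n * X  ≈⟨ *-congʳ (multiplier≈0 n) ⟩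
    0# * X            ≈⟨ zeroˡ X ⟩
    0#                ∎
    where
    X Y : Carrier
    X = CB n k
    Y = mulT CB n k
    collect : ∀ q a b c X Y →
      q * q * (1# - q) * (a * b * X) + ((Y + c * X) - q * (1# + q) * (a * X)) - (X + Y)
        ≈ (q * q * (1# - q) * (a * b) + (c - 1#) - q * (1# + q) * a) * X
    collect = solve 6 (λ q a b c X Y →
      q :* q :* (con (+ 1) :- q) :* (a :* b :* X) :+ ((Y :+ c :* X) :- q :* (con (+ 1) :+ q) :* (a :* X))
        :- (X :+ Y)
      := (q :* q :* (con (+ 1) :- q) :* (a :* b) :+ (c :- con (+ 1)) :- q :* (con (+ 1) :+ q) :* a) :* X) refl

lemma7p1 : ∀ {c ℓ} (R : CommutativeRing c ℓ) (q : CommutativeRing.Carrier R) →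
    let open CommutativeRing R
        open QSeries R q
    in ((k : ℕ) → at-x0 CB k ≈ one k)
       × ((n k : ℕ) →
           ( (q * q * (1# - q)) · mulX (mulX (Dq (Dq CB)))
             ⊕ (Dq CB ⊖ (q * (1# + q)) · mulX (Dq CB))
             ⊖ (CB ⊕ mulT CB) ) n k ≈ 0#)
lemma7p1 R q = CB-at-x0 , CB-equation
  where open QDifferentialEquation R q
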